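{- Let $n$ be a positive integer and let $l\ge 0$ be the integer with $2^l\leq n<2^{l+1}$. Let $p_{<n}(n)$ denote the number of partitions of $n$ whose product of summands is strictly less than $n$. Then \[ p_{<n}(n)=n-1+\sum_{k=2}^l\sum_{i_1=2}^{\left\lfloor\sqrt[k]{n}\right\rfloor}\sum_{i_2=i_1}^{\left\lfloor\sqrt[k-1]{\frac{n}{i_1}}\right\rfloor}\sum_{i_3=i_2}^{\left\lfloor\sqrt[k-2]{\frac{n}{i_1i_2}}\right\rfloor}\cdots\sum_{i_{k-1}=i_{k-2}}^{\left\lfloor\sqrt{\frac{n}{i_1i_2\cdots i_{k-2}}}\right\rfloor}\left(\left\lfloor\frac{n-1}{i_1i_2\cdots i_{k-1}}\right\rfloor-i_{k-1}+1\right), \] where for each $k$ the sum is a $(k-1)$-fold nested sum over integers $2\le i_1\le i_2\le\cdots\le i_{k-1}$ with the indicated upper limits (for $k=2$ it is the single sum $\sum_{i_1=2}^{\lfloor\sqrt{n}\rfloor}(\lfloor (n-1)/i_1\rfloor-i_1+1)$), and an empty sum is $0$.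
   Context: A partition of a non-negative integer $n$ is a representation of $n$ as a sum of unordered positive integers (its parts or summands). The product of the summands of a partition is the product of all its parts counted with multiplicity. $\lfloor x\rfloor$ denotes the greatest integer $\le x$. -}

module Defs where

open import Data.Bool using (Bool; if_then_else_)
open import Data.Nat using (ℕ; zero; suc; _+_; _*_; _∸_; _^_; _≤_; _<_; _≥_; _≤ᵇ_)
open import Data.Integer as ℤ using (ℤ; +_)
open import Data.List using (List)
open import Data.Nat.ListAction using (sum; product)
open import Data.List.Relation.Unary.All using (All)
open import Data.List.Relation.Unary.Linked using (Linked)
open import Data.Product using (_×_)
open import Relation.Binary.PropositionalEquality using (_≡_)

-- A partition of n: a list of positive parts, listed in non-increasing order
-- (so that unordered sums correspond to exactly one list), summing to n.
IsPartition : ℕ → List ℕ → Set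
IsPartition n p = Linked _≥_ p × All (1 ≤_) p × sum p ≡ n


-- largest m ≤ b with P m (0 if none)
maxSat : (ℕ → Bool) → ℕ → ℕ
maxSat P zero = zero
maxSat P (suc b) = if P (suc b) then suc b else maxSat P b

-- floorRoot r N Q = ⌊ (N / Q)^(1/r) ⌋ for r ≥ 1, Q ≥ 1, i.e. the largest m with m^r * Q ≤ N
-- (any such m satisfies m ≤ N, so searching below N suffices).
floorRoot : ℕ → ℕ → ℕ → ℕ
floorRoot r N Q = maxSat (λ m → (m ^ r) * Q ≤ᵇ N) N

-- floorDiv N Q = ⌊ N / Q ⌋ for Q ≥ 1: the largest q with q * Q ≤ N.
floorDiv : ℕ → ℕ → ℕ
floorDiv N Q = maxSat (λ q → q * Q ≤ᵇ N) N

-- Σ_{i=a}^{b} f i over ℤ, empty (= 0) when b < a.  Implemented as Σ_{j=0}^{b-a} f (a + j).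
sumFrom : ℕ → ℕ → (ℕ → ℤ) → ℤ
sumFrom a zero f = ℤ.0ℤ
sumFrom a (suc c) f = f a ℤ.+ sumFrom (suc a) c f

sumRange : ℕ → ℕ → (ℕ → ℤ) → ℤ
sumRange a b f = sumFrom a (suc b ∸ a) f

-- nest n r prev P : the remaining r-fold nested sum, where prev is the last chosen
-- index i_j (lower limit of the next one) and P = i_1 ⋯ i_j.
-- With r indices still to choose, the next upper limit is ⌊ (n/P)^(1/(r+1)) ⌋.
nest : ℕ → ℕ → ℕ → ℕ → ℤ
nest n zero prev P = (+ floorDiv (n ∸ 1) P ℤ.- + prev) ℤ.+ ℤ.1ℤ
nest n (suc r) prev P = sumRange prev (floorRoot (suc (suc r)) n P) (λ i → nest n r i (P * i))

term : ℕ → ℕ → ℤ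
term n k = nest n (k ∸ 1) 2 1

rhs : ℕ → ℕ → ℤ
rhs n l = (+ n ℤ.- ℤ.1ℤ) ℤ.+ sumRange 2 l (term n)

{-# OPTIONS --safe #-}
module Submission where

-- A partition of n whose product is < n is determined by its parts ≥ 2: listed in ascending
-- order they form a tuple 2 ≤ i₁ ≤ ⋯ ≤ i_k with i₁⋯i_k < n, and conversely every such tuple is
-- completed by ones to a partition of n, because a product of numbers ≥ 2 is at least their sum.
-- Since 2^k ≤ i₁⋯i_k < n < 2^(l+1), the length satisfies k ≤ l.  The empty tuple gives the
-- partition 1 + ⋯ + 1; for k ≥ 1 the admissible tuples are exactly those counted by the k-th
-- nested sum: i_j may range over i_(j-1) ≤ i_j with i_j^(k-j+1) · i₁⋯i_(j-1) ≤ n, and the innermost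
-- summand ⌊(n-1)/(i₁⋯i_(k-1))⌋ - i_(k-1) + 1 is the number of choices of the last part i_k.
-- For k = 1 this count is n - 2, which together with the empty tuple gives the term n - 1.

open import Defs
open import Data.Bool using (Bool; true; false; T)
open import Data.Empty using (⊥-elim)
open import Data.Integer as ℤ using (ℤ; +_)
import Data.Integer.Properties as ℤ
import Data.Integer.Tactic.RingSolver as ℤ-Solver
open import Data.List using (List; []; _∷_; _++_; [_]; map; concatMap; length; replicate; reverse; reverseAcc)
open import Data.List.Properties using (length-map; length-++; ∷-injectiveˡ; ∷-injectiveʳ; reverse-injective; reverse-involutive)
open import Data.List.Membership.Propositional using (_∈_; find; lose)
open import Data.List.Membership.Propositional.Properties using (∈-map⁺; ∈-map⁻; ∈-concatMap⁺; ∈-concatMap⁻)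
open import Data.List.Relation.Binary.Disjoint.Propositional using (Disjoint)
open import Data.List.Relation.Binary.Permutation.Propositional using (↭-sym)
open import Data.List.Relation.Binary.Permutation.Propositional.Properties using (↭-reverse; All-resp-↭)
open import Data.List.Relation.Unary.All as All using (All; []; _∷_)
import Data.List.Relation.Unary.All.Properties as All
import Data.List.Relation.Unary.AllPairs as AllPairs
import Data.List.Relation.Unary.AllPairs.Properties as AllPairs
open import Data.List.Relation.Unary.Any using (here; there)
open import Data.List.Relation.Unary.Linked as Linked using (Linked; []; [-]; _∷_)
open import Data.List.Relation.Unary.Linked.Properties using (Linked⇒All)
open import Data.List.Relation.Unary.Unique.Propositional using (Unique; []; _∷_)
import Data.List.Relation.Unary.Unique.Propositional.Properties as Unique
open import Data.Nat using (ℕ; zero; suc; _+_; _*_; _∸_; _^_; _≤_; _<_; z≤n; s≤s; s≤s⁻¹; z<s; _≤ᵇ_; NonZero; >-nonZero)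
open import Data.Nat.Properties
open import Data.Nat.ListAction using (sum; product)
open import Data.Nat.ListAction.Properties using (sum-↭; product-↭)
import Data.Nat.Tactic.RingSolver as ℕ-Solver
open import Data.Product using (Σ; ∃; ∃₂; _×_; _,_; proj₁; proj₂)
open import Data.Sum using (inj₁; inj₂)
open import Function using (_∘_; flip)
open import Function.Bundles using (_⇔_; mk⇔; Equivalence)
open import Level using (Level)
open import Relation.Binary.Core using (Rel)
open import Relation.Binary.PropositionalEquality hiding ([_])

open Equivalence using (to; from)

private
  variable
    a b ℓ : Level
    A : Set a
    B : Set b

m≤m^[1+n] : ∀ m n → m ≤ m ^ suc n
m≤m^[1+n] zero n = z≤n
m≤m^[1+n] m@(suc _) n = m≤m*n m (m ^ n) {{m^n≢0 m n}}

^-cancelʳ-< : ∀ b .{{_ : NonZero b}} {m n} → b ^ m < b ^ n → m < n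
^-cancelʳ-< b b^m<b^n = ≰⇒> (λ n≤m → <⇒≱ b^m<b^n (^-monoʳ-≤ b n≤m))

m+n≤m*n : ∀ {m n} → 2 ≤ m → 2 ≤ n → m + n ≤ m * n
m+n≤m*n (s≤s (s≤s (z≤n {a}))) (s≤s (s≤s (z≤n {b}))) = ≤-trans (m≤m+n _ (a + b + a * b)) (≤-reflexive (sym (expand a b)))
  where
  expand : ∀ a b → (2 + a) * (2 + b) ≡ ((2 + a) + (2 + b)) + (a + b + a * b)
  expand = ℕ-Solver.solve-∀

[m-n]+1≡[1+m]∸n : ∀ m n → n ≤ suc m → (+ m ℤ.- + n) ℤ.+ ℤ.1ℤ ≡ + (suc m ∸ n)
[m-n]+1≡[1+m]∸n m n n≤1+m = begin
  (+ m ℤ.- + n) ℤ.+ ℤ.1ℤ  ≡⟨ x-y+1≡1+x-y (+ m) (+ n) ⟩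
  + suc m ℤ.- + n         ≡⟨ ℤ.m-n≡m⊖n (suc m) n ⟩
  suc m ℤ.⊖ n             ≡⟨ ℤ.⊖-≥ n≤1+m ⟩
  + (suc m ∸ n)           ∎
  where
  open ≡-Reasoning
  x-y+1≡1+x-y : ∀ x y → (x ℤ.- y) ℤ.+ ℤ.1ℤ ≡ (ℤ.1ℤ ℤ.+ x) ℤ.- y
  x-y+1≡1+x-y = ℤ-Solver.solve-∀

Unique-concatMap⁺ : ∀ {f : A → List B} {xs} → Unique xs → (∀ x → Unique (f x)) →
                    (∀ {x y} → x ≢ y → Disjoint (f x) (f y)) → Unique (concatMap f xs)
Unique-concatMap⁺ {xs = xs} xs-unique f-unique f-disjoint = Unique.concat⁺
  (All.map⁺ (All.universal f-unique xs)) (AllPairs.map⁺ (AllPairs.map f-disjoint xs-unique))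

Unique-map⁺-on : ∀ {P : A → Set ℓ} {f : A → B} {xs} → All P xs →
                 (∀ {x y} → P x → P y → f x ≡ f y → x ≡ y) → Unique xs → Unique (map f xs)
Unique-map⁺-on [] _ [] = []
Unique-map⁺-on (px ∷ pxs) f-injective (x∉xs ∷ xs-unique) =
  All.map⁺ (All.zipWith (λ (x≢y , py) fx≡fy → x≢y (f-injective px py fx≡fy)) (x∉xs , pxs))
  ∷ Unique-map⁺-on pxs f-injective xs-unique

map-∷-disjoint : ∀ {x y : A} {xss yss} → x ≢ y → Disjoint (map (x ∷_) xss) (map (y ∷_) yss)
map-∷-disjoint x≢y (v∈ , v∈′) with ∈-map⁻ _ v∈ | ∈-map⁻ _ v∈′
... | _ , _ , refl | _ , _ , eq = x≢y (∷-injectiveˡ eq)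

Linked-reverseAcc⁺ : ∀ {R : Rel A ℓ} {x xs acc} → Linked R (x ∷ xs) → Linked (flip R) (x ∷ acc) →
                     Linked (flip R) (reverseAcc (x ∷ acc) xs)
Linked-reverseAcc⁺ [-]         Racc = Racc
Linked-reverseAcc⁺ (Rxy ∷ Rxs) Racc = Linked-reverseAcc⁺ Rxs (Rxy ∷ Racc)

Linked-reverse⁺ : ∀ {R : Rel A ℓ} {xs} → Linked R xs → Linked (flip R) (reverse xs)
Linked-reverse⁺ {xs = []}    []  = []
Linked-reverse⁺ {xs = _ ∷ _} Rxs = Linked-reverseAcc⁺ Rxs [-]

All-reverse⁺ : ∀ {P : A → Set ℓ} {xs} → All P xs → All P (reverse xs)
All-reverse⁺ {xs = xs} = All-resp-↭ (↭-sym (↭-reverse xs))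

Linked-≤⇒All : ∀ {b s} → Linked _≤_ (b ∷ s) → All (b ≤_) s
Linked-≤⇒All ≤s = All.tail (Linked⇒All ≤-trans ≤-refl ≤s)

1≤product : ∀ {s} → All (1 ≤_) s → 1 ≤ product s
1≤product []          = ≤-refl
1≤product (1≤x ∷ 1≤s) = *-mono-≤ 1≤x (1≤product 1≤s)

^length≤product : ∀ {b s} → Linked _≤_ (b ∷ s) → b ^ length s ≤ product s
^length≤product {s = []}    _           = ≤-refl
^length≤product {s = x ∷ s} (b≤x ∷ ≤s) =
  *-mono-≤ b≤x (≤-trans (^-monoˡ-≤ (length s) b≤x) (^length≤product ≤s))

sum≤product : ∀ {s} → All (2 ≤_) s → sum s ≤ product s
sum≤product []                     = z≤n
sum≤product {x ∷ []}    _          = ≤-reflexive (trans (+-identityʳ x) (sym (*-identityʳ x)))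
sum≤product {x ∷ y ∷ s} (2≤x ∷ 2≤ys) = ≤-trans (+-monoʳ-≤ x (sum≤product 2≤ys)) (m+n≤m*n 2≤x 2≤product)
  where
  2≤product : 2 ≤ product (y ∷ s)
  2≤product = *-mono-≤ (All.head 2≤ys) (1≤product (All.map (≤-trans (n≤1+n 1)) (All.tail 2≤ys)))

maxSat-satisfies : ∀ (P : ℕ → Bool) b → T (P 0) → T (P (maxSat P b))
maxSat-satisfies P zero P0 = P0
maxSat-satisfies P (suc b) P0 with P (suc b) in eq
... | true  = subst T (sym eq) _
... | false = maxSat-satisfies P b P0

≤-maxSat : ∀ (P : ℕ → Bool) {b m} → m ≤ b → T (P m) → m ≤ maxSat P b
≤-maxSat P {zero} m≤0 _ = m≤0
≤-maxSat P {suc b} m≤1+b Pm with P (suc b) in eq | m≤n⇒m<n∨m≡n m≤1+b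
... | true  | _ = m≤1+b
... | false | inj₁ m<1+b = ≤-maxSat P (s≤s⁻¹ m<1+b) Pm
... | false | inj₂ refl = ⊥-elim (subst T eq Pm)

≤-maxSat⇔ : ∀ (f : ℕ → ℕ) {N m} → (∀ {j k} → j ≤ k → f j ≤ f k) → (∀ k → k ≤ f k) → f 0 ≤ N →
            m ≤ maxSat (λ k → f k ≤ᵇ N) N ⇔ f m ≤ N
≤-maxSat⇔ f {N} {m} f-mono f-inflationary f0≤N = mk⇔
  (λ m≤max → ≤-trans (f-mono m≤max) (≤ᵇ⇒≤ _ N (maxSat-satisfies (λ k → f k ≤ᵇ N) N (≤⇒≤ᵇ f0≤N))))
  (λ fm≤N → ≤-maxSat _ (≤-trans (f-inflationary m) fm≤N) (≤⇒≤ᵇ fm≤N))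

≤-floorDiv⇔ : ∀ {N Q q} → 1 ≤ Q → q ≤ floorDiv N Q ⇔ q * Q ≤ N
≤-floorDiv⇔ {Q = Q} 1≤Q =
  ≤-maxSat⇔ (_* Q) (*-monoˡ-≤ Q) (λ k → m≤m*n k Q {{>-nonZero 1≤Q}}) z≤n

≤-floorDiv-pred⇔ : ∀ {n Q q} → 1 ≤ n → 1 ≤ Q → q ≤ floorDiv (n ∸ 1) Q ⇔ q * Q < n
≤-floorDiv-pred⇔ {suc n} _ 1≤Q = mk⇔ (s≤s ∘ to (≤-floorDiv⇔ 1≤Q)) (from (≤-floorDiv⇔ 1≤Q) ∘ s≤s⁻¹)

≤-floorRoot⇔ : ∀ {r N Q m} → 1 ≤ Q → m ≤ floorRoot (suc r) N Q ⇔ m ^ suc r * Q ≤ N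
≤-floorRoot⇔ {r} {Q = Q} 1≤Q = ≤-maxSat⇔ (λ m → m ^ suc r * Q)
  (λ j≤k → *-monoˡ-≤ Q (^-monoˡ-≤ (suc r) j≤k))
  (λ k → ≤-trans (m≤m^[1+n] k r) (m≤m*n _ Q {{>-nonZero 1≤Q}})) z≤n

floorDiv-identityʳ : ∀ N → floorDiv N 1 ≡ N
floorDiv-identityʳ N = ≤-antisym
  (subst (_≤ N) (*-identityʳ _) (to (≤-floorDiv⇔ ≤-refl) ≤-refl))
  (from (≤-floorDiv⇔ ≤-refl) (≤-reflexive (*-identityʳ N)))

rangeFrom : ℕ → ℕ → List ℕ
rangeFrom a zero    = []
rangeFrom a (suc c) = a ∷ rangeFrom (suc a) c

rangeBetween : ℕ → ℕ → List ℕ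
rangeBetween a b = rangeFrom a (suc b ∸ a)

length-rangeFrom : ∀ a c → length (rangeFrom a c) ≡ c
length-rangeFrom a zero    = refl
length-rangeFrom a (suc c) = cong suc (length-rangeFrom (suc a) c)

∈-rangeFrom⁻ : ∀ a c {i} → i ∈ rangeFrom a c → a ≤ i × i < a + c
∈-rangeFrom⁻ a (suc c) (here refl) = ≤-refl , m<m+n a z<s
∈-rangeFrom⁻ a (suc c) {i} (there i∈) with ∈-rangeFrom⁻ (suc a) c i∈
... | 1+a≤i , i<1+a+c = <⇒≤ 1+a≤i , subst (i <_) (sym (+-suc a c)) i<1+a+c

∈-rangeFrom⁺ : ∀ a c {i} → a ≤ i → i < a + c → i ∈ rangeFrom a c
∈-rangeFrom⁺ a zero {i} a≤i i<a+0 = ⊥-elim (<⇒≱ (subst (i <_) (+-identityʳ a) i<a+0) a≤i)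
∈-rangeFrom⁺ a (suc c) {i} a≤i i<a+1+c with m≤n⇒m<n∨m≡n a≤i
... | inj₂ refl = here refl
... | inj₁ a<i  = there (∈-rangeFrom⁺ (suc a) c a<i (subst (i <_) (+-suc a c) i<a+1+c))

rangeFrom-unique : ∀ a c → Unique (rangeFrom a c)
rangeFrom-unique a zero    = []
rangeFrom-unique a (suc c) =
  All.tabulate (λ i∈ → <⇒≢ (proj₁ (∈-rangeFrom⁻ (suc a) c i∈))) ∷ rangeFrom-unique (suc a) c

∈-rangeBetween⁻ : ∀ {a b i} → i ∈ rangeBetween a b → a ≤ i × i ≤ b
∈-rangeBetween⁻ {a} {b} {i} i∈ with ∈-rangeFrom⁻ a (suc b ∸ a) i∈ | ≤-total a (suc b)
... | a≤i , i<end | inj₁ a≤1+b = a≤i , s≤s⁻¹ (subst (i <_) (m+[n∸m]≡n a≤1+b) i<end)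
... | a≤i , i<end | inj₂ 1+b≤a =
  ⊥-elim (<⇒≱ (subst (i <_) (trans (cong (_+_ a) (m≤n⇒m∸n≡0 1+b≤a)) (+-identityʳ a)) i<end) a≤i)

∈-rangeBetween⁺ : ∀ {a b i} → a ≤ i → i ≤ b → i ∈ rangeBetween a b
∈-rangeBetween⁺ {a} {b} {i} a≤i i≤b = ∈-rangeFrom⁺ a (suc b ∸ a) a≤i
  (subst (i <_) (sym (m+[n∸m]≡n (≤-trans a≤i (m≤n⇒m≤1+n i≤b)))) (s≤s i≤b))

sumFrom-suc : ∀ a c (f : ℕ → ℤ) → sumFrom (suc a) c f ≡ sumFrom a c (f ∘ suc)
sumFrom-suc a zero    f = refl
sumFrom-suc a (suc c) f = cong (ℤ._+_ (f (suc a))) (sumFrom-suc (suc a) c f)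

sumFrom-length : ∀ a c {f : ℕ → ℤ} {g : ℕ → List A} → (∀ {i} → i ∈ rangeFrom a c → f i ≡ + length (g i)) →
                 sumFrom a c f ≡ + length (concatMap g (rangeFrom a c))
sumFrom-length a zero    _ = refl
sumFrom-length a (suc c) {f} {g} f≡ = begin
  f a ℤ.+ sumFrom (suc a) c f
    ≡⟨ cong₂ ℤ._+_ (f≡ (here refl)) (sumFrom-length (suc a) c (f≡ ∘ there)) ⟩
  + length (g a) ℤ.+ + length (concatMap g (rangeFrom (suc a) c))
    ≡⟨ cong +_ (sym (length-++ (g a))) ⟩
  + length (concatMap g (rangeFrom a (suc c)))
    ∎
  where open ≡-Reasoning

-- The tuples counted by nest n r prev P, of length r + 1 and entries ≥ prev; P is the product of
-- the indices chosen before.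
indices : ℕ → ℕ → ℕ → ℕ → List (List ℕ)
indicesStartingWith : ℕ → ℕ → ℕ → ℕ → List (List ℕ)

indices n zero    prev P = map [_] (rangeBetween prev (floorDiv (n ∸ 1) P))
indices n (suc r) prev P =
  concatMap (indicesStartingWith n r P) (rangeBetween prev (floorRoot (suc (suc r)) n P))

indicesStartingWith n r P i = map (i ∷_) (indices n r i (P * i))

∈-indices-suc⁻ : ∀ {n r prev P s} → s ∈ indices n (suc r) prev P →
                 ∃₂ λ i s′ → i ∈ rangeBetween prev (floorRoot (suc (suc r)) n P) × s′ ∈ indices n r i (P * i) × s ≡ i ∷ s′
∈-indices-suc⁻ {n} {r} {prev} {P} s∈
  with find (∈-concatMap⁻ (indicesStartingWith n r P) {rangeBetween prev (floorRoot (suc (suc r)) n P)} s∈)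
... | i , i∈ , s∈ᵢ with ∈-map⁻ (i ∷_) s∈ᵢ
... | s′ , s′∈ , refl = i , s′ , i∈ , s′∈ , refl

length-∈-indices : ∀ {n} r {prev P s} → s ∈ indices n r prev P → length s ≡ suc r
length-∈-indices zero s∈ with ∈-map⁻ [_] s∈
... | _ , _ , refl = refl
length-∈-indices {n} (suc r) {prev} {P} s∈ with ∈-indices-suc⁻ {n} {r} {prev} {P} s∈
... | _ , _ , _ , s′∈ , refl = cong suc (length-∈-indices r s′∈)

indices-unique : ∀ n r prev P → Unique (indices n r prev P)
indices-unique n zero    prev P = Unique.map⁺ ∷-injectiveˡ (rangeFrom-unique prev _)
indices-unique n (suc r) prev P = Unique-concatMap⁺ (rangeFrom-unique prev (suc (floorRoot (suc (suc r)) n P) ∸ prev))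
  (λ i → Unique.map⁺ ∷-injectiveʳ (indices-unique n r i (P * i))) map-∷-disjoint

module _ {n : ℕ} (1≤n : 1 ≤ n) where

  ∈-indices⁻ : ∀ r {prev P s} → 1 ≤ prev → 1 ≤ P → s ∈ indices n r prev P →
               Linked _≤_ (prev ∷ s) × P * product s < n
  ∈-indices⁻ zero {P = P} _ 1≤P s∈ with ∈-map⁻ [_] s∈
  ... | j , j∈ , refl with ∈-rangeBetween⁻ j∈
  ... | prev≤j , j≤ = prev≤j ∷ [-] ,
    subst (_< n) (trans (*-comm j P) (cong (P *_) (sym (*-identityʳ j)))) (to (≤-floorDiv-pred⇔ 1≤n 1≤P) j≤)
  ∈-indices⁻ (suc r) {prev} {P} 1≤prev 1≤P s∈ with ∈-indices-suc⁻ {n} {r} {prev} {P} s∈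
  ... | i , s′ , i∈ , s′∈ , refl with ∈-rangeBetween⁻ i∈
  ... | prev≤i , _ with ∈-indices⁻ r (≤-trans 1≤prev prev≤i) (*-mono-≤ 1≤P (≤-trans 1≤prev prev≤i)) s′∈
  ... | ≤s′ , Pis′<n = prev≤i ∷ ≤s′ , subst (_< n) (*-assoc P i (product s′)) Pis′<n

  ∈-indices⁺ : ∀ r {prev P s} → 1 ≤ prev → 1 ≤ P → Linked _≤_ (prev ∷ s) → length s ≡ suc r →
               P * product s < n → s ∈ indices n r prev P
  ∈-indices⁺ zero {P = P} {j ∷ []} _ 1≤P (prev≤j ∷ [-]) _ Pj<n = ∈-map⁺ [_] (∈-rangeBetween⁺ prev≤j
    (from (≤-floorDiv-pred⇔ 1≤n 1≤P) (subst (_< n) (trans (cong (P *_) (*-identityʳ j)) (*-comm P j)) Pj<n)))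
  ∈-indices⁺ (suc r) {prev} {P} {i ∷ s} 1≤prev 1≤P (prev≤i ∷ ≤s) |s|≡ Pis<n =
    ∈-concatMap⁺ (indicesStartingWith n r P) (lose (∈-rangeBetween⁺ prev≤i i≤root)
      (∈-map⁺ (i ∷_) (∈-indices⁺ r 1≤i (*-mono-≤ 1≤P 1≤i) ≤s |s|≡1+r
        (subst (_< n) (sym (*-assoc P i (product s))) Pis<n))))
    where
    1≤i : 1 ≤ i
    1≤i = ≤-trans 1≤prev prev≤i
    |s|≡1+r : length s ≡ suc r
    |s|≡1+r = suc-injective |s|≡
    i≤root : i ≤ floorRoot (suc (suc r)) n P
    i≤root = from (≤-floorRoot⇔ {suc r} 1≤P) (<⇒≤ (≤-<-trans (≤-trans
      (*-monoˡ-≤ P (*-monoʳ-≤ i (subst (λ k → i ^ k ≤ product s) |s|≡1+r (^length≤product ≤s))))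
      (≤-reflexive (*-comm (i * product s) P))) Pis<n))

nest≡length-indices : ∀ n r {prev P} → 1 ≤ prev → 1 ≤ P → prev ^ suc r * P ≤ n →
                      nest n r prev P ≡ + length (indices n r prev P)
nest≡length-indices n zero {prev@(suc p)} {P} _ 1≤P prev*P≤n = begin
  (+ floorDiv (n ∸ 1) P ℤ.- + prev) ℤ.+ ℤ.1ℤ       ≡⟨ [m-n]+1≡[1+m]∸n _ prev (s≤s p≤⌊[n-1]/P⌋) ⟩
  + (suc (floorDiv (n ∸ 1) P) ∸ prev)               ≡⟨ cong +_ (sym (length-rangeFrom prev _)) ⟩
  + length (rangeBetween prev (floorDiv (n ∸ 1) P)) ≡⟨ cong +_ (sym (length-map [_] (rangeBetween prev (floorDiv (n ∸ 1) P)))) ⟩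
  + length (map [_] (rangeBetween prev (floorDiv (n ∸ 1) P))) ∎
  where
  open ≡-Reasoning
  p≤⌊[n-1]/P⌋ : p ≤ floorDiv (n ∸ 1) P
  p≤⌊[n-1]/P⌋ = from (≤-floorDiv-pred⇔ (≤-trans 1≤P (≤-trans (m≤m+n P (p * P)) prev*P≤n′)) 1≤P)
    (<-≤-trans (m<n+m (p * P) 1≤P) prev*P≤n′)
    where
    prev*P≤n′ : P + p * P ≤ n
    prev*P≤n′ = subst (λ x → x * P ≤ n) (*-identityʳ prev) prev*P≤n
nest≡length-indices n (suc r) {prev} {P} 1≤prev 1≤P _ = sumFrom-length prev _ count-from
  where
  m*[n*o]≡[o*m]*n : ∀ m n o → m * (n * o) ≡ (o * m) * n
  m*[n*o]≡[o*m]*n = ℕ-Solver.solve-∀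
  count-from : ∀ {i} → i ∈ rangeBetween prev (floorRoot (suc (suc r)) n P) →
               nest n r i (P * i) ≡ + length (indicesStartingWith n r P i)
  count-from {i} i∈ with ∈-rangeBetween⁻ i∈
  ... | prev≤i , i≤root = trans
    (nest≡length-indices n r (≤-trans 1≤prev prev≤i) (*-mono-≤ 1≤P (≤-trans 1≤prev prev≤i))
      (subst (_≤ n) (sym (m*[n*o]≡[o*m]*n (i ^ suc r) P i)) (to (≤-floorRoot⇔ {suc r} 1≤P) i≤root)))
    (cong +_ (sym (length-map (i ∷_) (indices n r i (P * i)))))

sum-ones-++ : ∀ k s → sum (replicate k 1 ++ s) ≡ k + sum s
sum-ones-++ zero    s = refl
sum-ones-++ (suc k) s = cong suc (sum-ones-++ k s)

product-ones-++ : ∀ k s → product (replicate k 1 ++ s) ≡ product s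
product-ones-++ zero    s = refl
product-ones-++ (suc k) s = trans (*-identityˡ _) (product-ones-++ k s)

Linked-ones-++ : ∀ k {s} → Linked _≤_ (2 ∷ s) → Linked _≤_ (1 ∷ replicate k 1 ++ s)
Linked-ones-++ zero    {[]}    _          = [-]
Linked-ones-++ zero    {_ ∷ _} (2≤x ∷ ≤s) = ≤-trans (n≤1+n 1) 2≤x ∷ ≤s
Linked-ones-++ (suc k)         ≤s         = ≤-refl ∷ Linked-ones-++ k ≤s

ones-++-cancelˡ : ∀ j k {s t} → Linked _≤_ (2 ∷ s) → Linked _≤_ (2 ∷ t) →
                  replicate j 1 ++ s ≡ replicate k 1 ++ t → s ≡ t
ones-++-cancelˡ zero    zero    _ _ s≡t = s≡t
ones-++-cancelˡ (suc j) (suc k) ≤s ≤t eq = ones-++-cancelˡ j k ≤s ≤t (∷-injectiveʳ eq)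
ones-++-cancelˡ zero    (suc k) (s≤s () ∷ _) _ refl
ones-++-cancelˡ (suc j) zero    _ (s≤s () ∷ _) refl

ones-++-split : ∀ {q} → Linked _≤_ q → All (1 ≤_) q → ∃₂ λ k s → q ≡ replicate k 1 ++ s × Linked _≤_ (2 ∷ s)
ones-++-split {[]}                _   _           = 0 , [] , refl , [-]
ones-++-split {suc zero ∷ q}      ≤q  (_ ∷ 1≤q)   with ones-++-split (Linked.tail ≤q) 1≤q
... | k , s , q≡ , ≤s = suc k , s , cong (1 ∷_) q≡ , ≤s
ones-++-split {suc (suc x) ∷ q}   ≤q  _           = 0 , _ , refl , s≤s (s≤s z≤n) ∷ ≤q

-- The parts ≥ 2 of a partition of n with product < n, in ascending order; the number of parts 1
-- is then determined by n.
Core : ℕ → List ℕ → Set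
Core n s = Linked _≤_ (2 ∷ s) × product s < n

partitionOf : ℕ → List ℕ → List ℕ
partitionOf n s = reverse (replicate (n ∸ sum s) 1 ++ s)

partitionOf-small : ∀ {n s} → Core n s → IsPartition n (partitionOf n s) × product (partitionOf n s) < n
partitionOf-small {n} {s} (≤s , s<n) =
  (Linked-reverse⁺ (Linked.tail ≤q) , All-reverse⁺ (Linked-≤⇒All ≤q) , sum≡n) , product<n
  where
  k = n ∸ sum s
  q = replicate k 1 ++ s
  ≤q : Linked _≤_ (1 ∷ q)
  ≤q = Linked-ones-++ k ≤s
  sum≡n : sum (reverse q) ≡ n
  sum≡n = begin
    sum (reverse q) ≡⟨ sum-↭ (↭-reverse q) ⟩
    sum q           ≡⟨ sum-ones-++ k s ⟩
    k + sum s       ≡⟨ m∸n+n≡m (≤-trans (sum≤product (Linked-≤⇒All ≤s)) (<⇒≤ s<n)) ⟩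
    n               ∎
    where open ≡-Reasoning
  product<n : product (reverse q) < n
  product<n = subst (_< n) (sym (trans (product-↭ (↭-reverse q)) (product-ones-++ k s))) s<n

partitionOf-injective : ∀ {n s t} → Linked _≤_ (2 ∷ s) → Linked _≤_ (2 ∷ t) →
                        partitionOf n s ≡ partitionOf n t → s ≡ t
partitionOf-injective {n} {s} {t} ≤s ≤t eq = ones-++-cancelˡ (n ∸ sum s) (n ∸ sum t) ≤s ≤t (reverse-injective eq)

small⇒partitionOf : ∀ {n p} → IsPartition n p → product p < n → ∃ λ s → Core n s × p ≡ partitionOf n s
small⇒partitionOf {n} {p} (≥p , 1≤p , sum≡n) p<n with ones-++-split (Linked-reverse⁺ ≥p) (All-reverse⁺ 1≤p)
... | k , s , p′≡ , ≤s = s , (≤s , s<n) , p≡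
  where
  open ≡-Reasoning
  s<n : product s < n
  s<n = subst (_< n) (begin
    product p                     ≡⟨ product-↭ (↭-reverse p) ⟨
    product (reverse p)           ≡⟨ cong product p′≡ ⟩
    product (replicate k 1 ++ s)  ≡⟨ product-ones-++ k s ⟩
    product s                     ∎) p<n
  k≡ : n ∸ sum s ≡ k
  k≡ = begin
    n ∸ sum s                           ≡⟨ cong (_∸ sum s) (trans (sum-↭ (↭-reverse p)) sum≡n) ⟨
    sum (reverse p) ∸ sum s             ≡⟨ cong (λ q → sum q ∸ sum s) p′≡ ⟩
    sum (replicate k 1 ++ s) ∸ sum s    ≡⟨ cong (_∸ sum s) (sum-ones-++ k s) ⟩
    k + sum s ∸ sum s                   ≡⟨ m+n∸n≡m k (sum s) ⟩
    k                                   ∎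
  p≡ : p ≡ partitionOf n s
  p≡ = begin
    p                              ≡⟨ reverse-involutive p ⟨
    reverse (reverse p)            ≡⟨ cong reverse p′≡ ⟩
    reverse (replicate k 1 ++ s)   ≡⟨ cong (λ j → reverse (replicate j 1 ++ s)) k≡ ⟨
    partitionOf n s                ∎

cores : ℕ → ℕ → List (List ℕ)
cores n l = [] ∷ concatMap (λ r → indices n r 2 1) (rangeFrom 0 l)

∈-cores⁻ : ∀ {n l s} → 2 ≤ n → s ∈ cores n l → Core n s
∈-cores⁻ 2≤n (here refl) = [-] , 2≤n
∈-cores⁻ {n} {l} 2≤n (there s∈) with find (∈-concatMap⁻ (λ r → indices n r 2 1) {rangeFrom 0 l} s∈)
... | r , _ , s∈ᵣ with ∈-indices⁻ (<⇒≤ 2≤n) r (s≤s z≤n) ≤-refl s∈ᵣ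
... | ≤s , s<n = ≤s , subst (_< n) (*-identityˡ _) s<n

∈-cores⁺ : ∀ {n l s} → n < 2 ^ (l + 1) → Core n s → s ∈ cores n l
∈-cores⁺ {s = []}     _ _ = here refl
∈-cores⁺ {n} {l} {s@(_ ∷ s′)} n<2^[l+1] (≤s , s<n) =
  there (∈-concatMap⁺ (λ r → indices n r 2 1) (lose (∈-rangeFrom⁺ 0 l z≤n |s′|<l)
    (∈-indices⁺ (≤-trans (s≤s z≤n) s<n) (length s′) (s≤s z≤n) ≤-refl ≤s refl
      (subst (_< n) (sym (*-identityˡ _)) s<n))))
  where
  |s′|<l : length s′ < l
  |s′|<l = s≤s⁻¹ (subst (suc (length s′) <_) (+-comm l 1)
    (^-cancelʳ-< 2 (≤-<-trans (^length≤product ≤s) (<-trans s<n n<2^[l+1]))))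

cores-unique : ∀ n l → Unique (cores n l)
cores-unique n l =
  All.tabulate nonempty ∷ Unique-concatMap⁺ (rangeFrom-unique 0 l) (λ r → indices-unique n r 2 1) lengths-differ
  where
  nonempty : ∀ {s} → s ∈ concatMap (λ r → indices n r 2 1) (rangeFrom 0 l) → [] ≢ s
  nonempty s∈ refl with find (∈-concatMap⁻ (λ r → indices n r 2 1) {rangeFrom 0 l} s∈)
  ... | r , _ , s∈ᵣ with length-∈-indices {n} r {2} {1} s∈ᵣ
  ... | ()
  lengths-differ : ∀ {r r′} → r ≢ r′ → Disjoint (indices n r 2 1) (indices n r′ 2 1)
  lengths-differ {r} {r′} r≢r′ (s∈ , s∈′) =
    r≢r′ (suc-injective (trans (sym (length-∈-indices {n} r s∈)) (length-∈-indices {n} r′ s∈′)))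

length-cores : ∀ {n l} → 2 ^ l ≤ n → + length (cores n l) ≡ ℤ.1ℤ ℤ.+ sumFrom 1 l (term n)
length-cores {n} {l} 2^l≤n = begin
  ℤ.1ℤ ℤ.+ + length (concatMap (λ r → indices n r 2 1) (rangeFrom 0 l))
    ≡⟨ cong (ℤ._+_ ℤ.1ℤ) (sumFrom-length 0 l count) ⟨
  ℤ.1ℤ ℤ.+ sumFrom 0 l (λ r → nest n r 2 1)
    ≡⟨ cong (ℤ._+_ ℤ.1ℤ) (sumFrom-suc 0 l (term n)) ⟨
  ℤ.1ℤ ℤ.+ sumFrom 1 l (term n)
    ∎
  where
  open ≡-Reasoning
  count : ∀ {r} → r ∈ rangeFrom 0 l → nest n r 2 1 ≡ + length (indices n r 2 1)
  count {r} r∈ = nest≡length-indices n r (s≤s z≤n) ≤-refl (≤-trans (≤-reflexive (*-identityʳ _))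
    (≤-trans (^-monoʳ-≤ 2 (proj₂ (∈-rangeFrom⁻ 0 l r∈))) 2^l≤n))

1+term[n,1]≡n-1 : ∀ {n} → 2 ≤ n → ℤ.1ℤ ℤ.+ term n 1 ≡ + n ℤ.- ℤ.1ℤ
1+term[n,1]≡n-1 {suc zero}    (s≤s ())
1+term[n,1]≡n-1 {suc (suc m)} _ = cong (ℤ._+_ ℤ.1ℤ) (begin
  (+ floorDiv (suc m) 1 ℤ.- + 2) ℤ.+ ℤ.1ℤ  ≡⟨ cong (λ x → (+ x ℤ.- + 2) ℤ.+ ℤ.1ℤ) (floorDiv-identityʳ (suc m)) ⟩
  (+ suc m ℤ.- + 2) ℤ.+ ℤ.1ℤ              ≡⟨ [m-n]+1≡[1+m]∸n (suc m) 2 (s≤s (s≤s z≤n)) ⟩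
  + m                                     ∎)
  where open ≡-Reasoning

length-cores≡rhs : ∀ {n l} → 2 ≤ n → 2 ^ suc l ≤ n → + length (cores n (suc l)) ≡ rhs n (suc l)
length-cores≡rhs {n} {l} 2≤n 2^[1+l]≤n = begin
  + length (cores n (suc l))                            ≡⟨ length-cores {n} {suc l} 2^[1+l]≤n ⟩
  ℤ.1ℤ ℤ.+ (term n 1 ℤ.+ sumFrom 2 l (term n))          ≡⟨ ℤ.+-assoc ℤ.1ℤ (term n 1) _ ⟨
  (ℤ.1ℤ ℤ.+ term n 1) ℤ.+ sumFrom 2 l (term n)          ≡⟨ cong (ℤ._+ sumFrom 2 l (term n)) (1+term[n,1]≡n-1 2≤n) ⟩
  rhs n (suc l)                                          ∎
  where open ≡-Reasoning

smallPartitions : ℕ → ℕ → List (List ℕ)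
smallPartitions n l = map (partitionOf n) (cores n l)

smallPartitions-unique : ∀ {n} l → 2 ≤ n → Unique (smallPartitions n l)
smallPartitions-unique {n} l 2≤n = Unique-map⁺-on (All.tabulate (proj₁ ∘ ∈-cores⁻ {n} {l} 2≤n))
  partitionOf-injective (cores-unique n l)

∈-smallPartitions⇔ : ∀ {n l p} → 2 ≤ n → n < 2 ^ (l + 1) →
                     p ∈ smallPartitions n l ⇔ (IsPartition n p × product p < n)
∈-smallPartitions⇔ {n} {l} {p} 2≤n n<2^[l+1] = mk⇔ sound complete
  where
  sound : p ∈ smallPartitions n l → IsPartition n p × product p < n
  sound p∈ with ∈-map⁻ (partitionOf n) p∈
  ... | s , s∈ , refl = partitionOf-small (∈-cores⁻ {n} {l} 2≤n s∈)
  complete : IsPartition n p × product p < n → p ∈ smallPartitions n l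
  complete (p-partition , p<n) with small⇒partitionOf p-partition p<n
  ... | s , core , refl = ∈-map⁺ (partitionOf n) (∈-cores⁺ {n} {l} n<2^[l+1] core)

length-smallPartitions : ∀ {n l} → 2 ≤ n → 2 ^ suc l ≤ n → + length (smallPartitions n (suc l)) ≡ rhs n (suc l)
length-smallPartitions {n} {l} 2≤n 2^[1+l]≤n =
  trans (cong +_ (length-map (partitionOf n) (cores n (suc l)))) (length-cores≡rhs {n} {l} 2≤n 2^[1+l]≤n)

corollary1 : (n l : ℕ) → 1 ≤ n → 2 ^ l ≤ n → n < 2 ^ (l + 1) →
    Σ (List (List ℕ)) (λ L →
      Unique L ×
      ((p : List ℕ) → (p ∈ L) ⇔ (IsPartition n p × product p < n)) ×
      + length L ≡ rhs n l)
corollary1 (suc zero) zero _ _ _ =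
  [] , [] , (λ p → mk⇔ (λ ()) (λ ((_ , 1≤p , _) , p<1) → ⊥-elim (<⇒≱ p<1 (1≤product 1≤p)))) , refl
corollary1 (suc zero) (suc l) _ 2^[1+l]≤1 _ = ⊥-elim (1+n≰n (≤-trans (*-monoʳ-≤ 2 (m^n>0 2 l)) 2^[1+l]≤1))
corollary1 (suc (suc _)) zero _ _ (s≤s (s≤s ()))
corollary1 n@(suc (suc _)) (suc l) _ 2^[1+l]≤n n<2^[2+l] =
  smallPartitions n (suc l) ,
  smallPartitions-unique (suc l) 2≤n ,
  (λ p → ∈-smallPartitions⇔ {n} {suc l} 2≤n n<2^[2+l]) ,
  length-smallPartitions {n} {l} 2≤n 2^[1+l]≤n
  where
  2≤n : 2 ≤ n
  2≤n = s≤s (s≤s z≤n)
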